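{- Let $p$ be a Sophie Germain prime with $p\equiv 3 \pmod 8$, and let $k\geq 1$ be an integer. Then the only non-negative integer solutions of the equation $p^x+(2^{2k}(2p+1))^y=z^2$ are $(p,x,y,z)=(3,1,0,2)$ (for any $k$) and $(p,k,x,y,z)=(3,2,6,1,29)$, $(3,2,2,1,11)$, $(3,3,4,1,23)$.
   Context: A prime $p$ is called a Sophie Germain prime if $2p+1$ is also prime. -}

module Defs where

open import Data.Nat using (ℕ; _+_; _*_)
open import Data.Nat.Primality using (Prime)
open import Data.Product using (_×_)

SophieGermainPrime : ℕ → Set
SophieGermainPrime p = Prime p × Prime (2 * p + 1)

{-# OPTIONS --safe #-}
module Submission where

-- Write q = 2p + 1 and n = ky.  For y = 0, (z - 1)(z + 1) = p^x with p ∤ 2 forces z - 1 = 1.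
-- For y ≥ 1, x is even since p^x ≡ 3 (mod 4) for odd x and 4 ∣ 2^(2n).  With P = p^(x/2) and
-- z = P + 2a the equation becomes a (a + P) = 2^(2n-2) q^y; as P is odd and prime to q, the
-- factors split as (1, 2^(2n-2) q^y), (2^(2n-2), q^y) or (q^y, 2^(2n-2)).  In each of the three
-- resulting equations, congruences modulo 8 bound n (and fix parities of exponents), q ≡ 1 (mod p)
-- forces p = 3, and where an exponent turns out even a second difference-of-squares
-- factorisation finishes the job.

open import Defs
open import Data.Nat using (ℕ; _+_; _*_; _^_; _%_; _≥_)
open import Data.Product using (_×_)
open import Data.Sum using (_⊎_)
open import Relation.Binary.PropositionalEquality using (_≡_)

open import Data.Nat using (zero; suc; _≤_; _<_; _≤?_; _<?_; z≤n; s≤s; NonZero; ≢-nonZero⁻¹)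
open import Data.Nat.Properties
open import Data.Nat.DivMod
  using (%-distribˡ-+; %-distribˡ-*; %-congˡ; %-remove-+ˡ; %-remove-+ʳ; m<n⇒m%n≡m; m%n≤m; m%n<n; m∣n⇒o%n%m≡o%m)
open import Data.Nat.Divisibility
open import Data.Nat.Primality using (Prime; ¬prime[1]; prime[2]; prime⇒nonZero; prime⇒irreducible; euclidsLemma)
open import Data.Nat.Coprimality using (Coprime; coprime-divisor)
open import Data.Nat.Tactic.RingSolver using (solve-∀)
open import Data.Product using (∃-syntax; _,_)
open import Data.Sum using (inj₁; inj₂; [_,_]′)
open import Function using (id; _∘_)
open import Relation.Nullary using (¬_; yes; no; contradiction)
open import Relation.Nullary.Decidable using (from-yes; from-no)
open import Relation.Binary.PropositionalEquality using (_≢_; refl; sym; trans; cong; cong₂; subst; module ≡-Reasoning)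
open import Relation.Binary.Definitions using (tri<; tri≈; tri>)

open ≡-Reasoning

^-distribʳ-* : ∀ m n k → (m * n) ^ k ≡ m ^ k * n ^ k
^-distribʳ-* m n zero    = refl
^-distribʳ-* m n (suc k) = trans (cong (m * n *_) (^-distribʳ-* m n k)) (interchange m n (m ^ k) (n ^ k))
  where
  interchange : ∀ a b c d → a * b * (c * d) ≡ a * c * (b * d)
  interchange = solve-∀

^-double : ∀ m n → m ^ (2 * n) ≡ m ^ n * m ^ n
^-double m n = trans (cong (λ e → m ^ (n + e)) (+-identityʳ n)) (^-distribˡ-+-* m n n)

^-injectiveʳ : ∀ {b} → 1 < b → ∀ {m n} → b ^ m ≡ b ^ n → m ≡ n
^-injectiveʳ {b} 1<b {m} {n} eq with <-cmp m n
... | tri< m<n _ _ = contradiction eq (<⇒≢ (^-monoʳ-< b 1<b m<n))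
... | tri≈ _ m≡n _ = m≡n
... | tri> _ _ n<m = contradiction eq (>⇒≢ (^-monoʳ-< b 1<b n<m))

^-between : ∀ b .{{_ : NonZero b}} m {c} → b ^ m < c → c < b ^ suc m → ∀ r → b ^ r ≢ c
^-between b m b^m<c c<b^[1+m] r refl with r ≤? m
... | yes r≤m = <⇒≱ b^m<c (^-monoʳ-≤ b r≤m)
... | no  r≰m = <⇒≱ c<b^[1+m] (^-monoʳ-≤ b (≰⇒> r≰m))

4^suc : ∀ n → 2 ^ (2 * suc n) ≡ 4 * 2 ^ (2 * n)
4^suc n = begin
  2 ^ (2 * suc n)     ≡⟨ sym (^-*-assoc 2 2 (suc n)) ⟩
  4 ^ suc n           ≡⟨ cong (4 *_) (^-*-assoc 2 2 n) ⟩
  4 * 2 ^ (2 * n)     ∎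

8∣2^[3+n] : ∀ n → 8 ∣ 2 ^ (3 + n)
8∣2^[3+n] n = divides (2 ^ n) (eight (2 ^ n))
  where
  eight : ∀ x → 2 * (2 * (2 * x)) ≡ x * 8
  eight = solve-∀

8∣4^[2+n] : ∀ n → 8 ∣ 2 ^ (2 * (2 + n))
8∣4^[2+n] n = subst (λ e → 8 ∣ 2 ^ e) (exponent n) (8∣2^[3+n] (1 + 2 * n))
  where
  exponent : ∀ n → 3 + (1 + 2 * n) ≡ 2 * (2 + n)
  exponent = solve-∀

[4^k*c]^y : ∀ k y c → (2 ^ (2 * suc k) * c) ^ suc y ≡ 4 * (2 ^ (2 * (y + k * suc y)) * c ^ suc y)
[4^k*c]^y k y c = begin
  (2 ^ (2 * suc k) * c) ^ suc y                 ≡⟨ ^-distribʳ-* (2 ^ (2 * suc k)) c (suc y) ⟩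
  (2 ^ (2 * suc k)) ^ suc y * c ^ suc y         ≡⟨ cong (_* c ^ suc y) (^-*-assoc 2 (2 * suc k) (suc y)) ⟩
  2 ^ (2 * suc k * suc y) * c ^ suc y           ≡⟨ cong (λ e → 2 ^ e * c ^ suc y) (*-assoc 2 (suc k) (suc y)) ⟩
  2 ^ (2 * suc (y + k * suc y)) * c ^ suc y     ≡⟨ cong (_* c ^ suc y) (4^suc (y + k * suc y)) ⟩
  4 * 2 ^ (2 * (y + k * suc y)) * c ^ suc y     ≡⟨ *-assoc 4 (2 ^ (2 * (y + k * suc y))) (c ^ suc y) ⟩
  4 * (2 ^ (2 * (y + k * suc y)) * c ^ suc y)   ∎

data EvenOdd : ℕ → Set where
  even : ∀ s → EvenOdd (2 * s)
  odd  : ∀ s → EvenOdd (1 + 2 * s)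

evenOdd : ∀ n → EvenOdd n
evenOdd zero = even 0
evenOdd (suc n) with evenOdd n
... | even s = odd s
... | odd s  = subst EvenOdd (cong suc (+-suc s (s + 0))) (even (suc s))

module _ (d : ℕ) .{{_ : NonZero d}} where

  +-%-cong : ∀ m n {a b} → m % d ≡ a → n % d ≡ b → (m + n) % d ≡ (a + b) % d
  +-%-cong m n refl refl = %-distribˡ-+ m n d

  *-%-cong : ∀ m n {a b} → m % d ≡ a → n % d ≡ b → (m * n) % d ≡ (a * b) % d
  *-%-cong m n refl refl = %-distribˡ-* m n d

  *-%≡1ʳ : ∀ m {n} → n % d ≡ 1 % d → (m * n) % d ≡ m % d
  *-%≡1ʳ m {n} n≡1 = begin
    (m * n) % d               ≡⟨ *-%-cong m n refl n≡1 ⟩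
    (m % d * (1 % d)) % d     ≡⟨ sym (%-distribˡ-* m 1 d) ⟩
    (m * 1) % d               ≡⟨ cong (_% d) (*-identityʳ m) ⟩
    m % d                     ∎

  ^-%≡1 : ∀ m → m % d ≡ 1 % d → ∀ k → m ^ k % d ≡ 1 % d
  ^-%≡1 m m≡1 zero    = refl
  ^-%≡1 m m≡1 (suc k) = trans (*-%≡1ʳ m (^-%≡1 m m≡1 k)) m≡1

  ^-even-% : ∀ m → (m * m) % d ≡ 1 % d → ∀ s → m ^ (2 * s) % d ≡ 1 % d
  ^-even-% m m²≡1 s = begin
    m ^ (2 * s) % d   ≡⟨ cong (_% d) (sym (^-*-assoc m 2 s)) ⟩
    (m ^ 2) ^ s % d   ≡⟨ ^-%≡1 (m ^ 2) (trans (cong (λ x → (m * x) % d) (*-identityʳ m)) m²≡1) s ⟩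
    1 % d             ∎

  ^-odd-% : ∀ m → (m * m) % d ≡ 1 % d → ∀ s → m ^ (1 + 2 * s) % d ≡ m % d
  ^-odd-% m m²≡1 s = *-%≡1ʳ m (^-even-% m m²≡1 s)

  residues≢⇒≢ : ∀ {m n a b} → m % d ≡ a → n % d ≡ b → a ≢ b → m ≢ n
  residues≢⇒≢ refl refl a≢b m≡n = a≢b (%-congˡ m≡n)

square%4≢3 : ∀ m → (m * m) % 4 ≢ 3
square%4≢3 m = small (m % 4) (m%n<n m 4) ∘ trans (sym (%-distribˡ-* m m 4))
  where
  small : ∀ r → r < 4 → (r * r) % 4 ≢ 3
  small 0 _ ()
  small 1 _ ()
  small 2 _ ()
  small 3 _ ()
  small (suc (suc (suc (suc _)))) (s≤s (s≤s (s≤s (s≤s ()))))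

prime∤⇒coprime : ∀ {p m} → Prime p → ¬ p ∣ m → Coprime m p
prime∤⇒coprime p-prime p∤m (i∣m , i∣p) with prime⇒irreducible p-prime i∣p
... | inj₁ i≡1 = i≡1
... | inj₂ refl = contradiction i∣m p∤m

∣p^⇒≡p^ : ∀ {p} → Prime p → ∀ {d} k → d ∣ p ^ k → ∃[ i ] d ≡ p ^ i
∣p^⇒≡p^ p-prime zero d∣1 = 0 , ∣1⇒≡1 d∣1
∣p^⇒≡p^ {p} p-prime {d} (suc k) d∣p^[1+k] with p ∣? d
... | no p∤d = ∣p^⇒≡p^ p-prime k (coprime-divisor (prime∤⇒coprime p-prime p∤d) d∣p^[1+k])
... | yes (divides c refl) with ∣p^⇒≡p^ p-prime k c∣p^k
  where
  c∣p^k : c ∣ p ^ k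
  c∣p^k = *-cancelʳ-∣ p {{prime⇒nonZero p-prime}} (subst (c * p ∣_) (*-comm p (p ^ k)) d∣p^[1+k])
...   | i , refl = suc i , *-comm (p ^ i) p

prime∤⇒∤^ : ∀ {p m} → Prime p → ¬ p ∣ m → ∀ k → ¬ p ∣ m ^ k
prime∤⇒∤^ p-prime p∤m zero    p∣1 = ¬prime[1] (subst Prime (∣1⇒≡1 p∣1) p-prime)
prime∤⇒∤^ p-prime p∤m (suc k) p∣m^[1+k] =
  [ p∤m , prime∤⇒∤^ p-prime p∤m k ]′ (euclidsLemma _ _ p-prime p∣m^[1+k])

prime^-coprime : ∀ {p n} → Prime p → ¬ p ∣ n → ∀ k → Coprime (p ^ k) n
prime^-coprime p-prime p∤n k (i∣p^k , i∣n) with ∣p^⇒≡p^ p-prime k i∣p^k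
... | zero  , i≡1  = i≡1
... | suc j , refl = contradiction (∣-trans (m∣m*n _) i∣n) p∤n

prime^-absorb : ∀ {p m n k c} → Prime p → ¬ p ∣ n → m * n ≡ p ^ k * c →
  ∃[ w ] m ≡ p ^ k * w × w * n ≡ c
prime^-absorb {p} {m} {n} {k} {c} p-prime p∤n eq
  with coprime-divisor (prime^-coprime p-prime p∤n k) (divides c (trans (*-comm n m) (trans eq (*-comm (p ^ k) c))))
... | divides w m≡w*p^k = w , trans m≡w*p^k (*-comm w (p ^ k)) ,
  *-cancelˡ-≡ (w * n) c (p ^ k) {{m^n≢0 p k {{prime⇒nonZero p-prime}}}} (begin
    p ^ k * (w * n)  ≡⟨ sym (*-assoc (p ^ k) w n) ⟩
    p ^ k * w * n    ≡⟨ cong (_* n) (trans (*-comm (p ^ k) w) (sym m≡w*p^k)) ⟩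
    m * n            ≡⟨ eq ⟩
    p ^ k * c        ∎)

coprime-factors-of-prime^ : ∀ {p m n k} → Prime p → m * n ≡ p ^ k → ¬ (p ∣ m × p ∣ n) → m ≡ 1 ⊎ n ≡ 1
coprime-factors-of-prime^ {p} {m} {n} {k} p-prime eq not-both
  with ∣p^⇒≡p^ p-prime k (subst (m ∣_) eq (m∣m*n n)) | ∣p^⇒≡p^ p-prime k (subst (n ∣_) eq (n∣m*n m))
... | zero  , m≡1 | _            = inj₁ m≡1
... | suc _ , _   | zero  , n≡1  = inj₂ n≡1
... | suc i , m≡  | suc j , n≡   = contradiction (p∣p^[1+] i m≡ , p∣p^[1+] j n≡) not-both
  where
  p∣p^[1+] : ∀ {x} l → x ≡ p ^ suc l → p ∣ x
  p∣p^[1+] l refl = m∣m*n (p ^ l)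

m*[m+n]≡p^⇒m≡1 : ∀ {p m n k} → Prime p → ¬ p ∣ n → m * (m + n) ≡ p ^ k → m ≡ 1
m*[m+n]≡p^⇒m≡1 {p} {m} {n} {k} p-prime p∤n eq
  with coprime-factors-of-prime^ {k = k} p-prime eq (λ (p∣m , p∣m+n) → p∤n (∣m+n∣m⇒∣n p∣m+n p∣m))
... | inj₁ m≡1   = m≡1
... | inj₂ m+n≡1 with n≤1⇒n≡0∨n≡1 (subst (m ≤_) m+n≡1 (m≤m+n m n))
...   | inj₂ m≡1 = m≡1
...   | inj₁ refl = contradiction (sym eq) (≢-nonZero⁻¹ (p ^ k) {{m^n≢0 p k {{prime⇒nonZero p-prime}}}})

-- Exactly one of u and u + P is odd and absorbs no factor 2; q divides at most one of them.
factor-pair-split : ∀ {q P} → Prime q → ¬ 2 ∣ P → ¬ q ∣ P → ∀ u n y →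
  u * (u + P) ≡ 2 ^ n * q ^ y →
  (u ≡ 1 × u + P ≡ 2 ^ n * q ^ y) ⊎ (u ≡ 2 ^ n × u + P ≡ q ^ y) ⊎ (u ≡ q ^ y × u + P ≡ 2 ^ n)
factor-pair-split {q} {P} q-prime 2∤P q∤P u n y eq with 2 ∣? u
... | no 2∤u with prime^-absorb {k = n} prime[2] 2∤u (trans (*-comm (u + P) u) eq)
...   | w , u+P≡2^n*w , w*u≡q^y
      with coprime-factors-of-prime^ {m = u} {n = w} {k = y} q-prime (trans (*-comm u w) w*u≡q^y)
             (λ (q∣u , q∣w) →
               q∤P (∣m+n∣m⇒∣n (subst (q ∣_) (sym u+P≡2^n*w) (∣n⇒∣m*n (2 ^ n) q∣w)) q∣u))
...     | inj₁ refl = inj₁ (refl , trans u+P≡2^n*w (cong (2 ^ n *_) (trans (sym (*-identityʳ w)) w*u≡q^y)))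
...     | inj₂ refl = inj₂ (inj₂ (trans (sym (*-identityˡ u)) w*u≡q^y , trans u+P≡2^n*w (*-identityʳ (2 ^ n))))
factor-pair-split {q} {P} q-prime 2∤P q∤P u n y eq | yes 2∣u
  with prime^-absorb {k = n} prime[2] (λ 2∣u+P → 2∤P (∣m+n∣m⇒∣n 2∣u+P 2∣u)) eq
... | w , u≡2^n*w , w*[u+P]≡q^y
    with coprime-factors-of-prime^ {m = w} {n = u + P} {k = y} q-prime w*[u+P]≡q^y
           (λ (q∣w , q∣u+P) →
             q∤P (∣m+n∣m⇒∣n q∣u+P (subst (q ∣_) (sym u≡2^n*w) (∣n⇒∣m*n (2 ^ n) q∣w))))
...   | inj₁ refl = inj₂ (inj₁ (trans u≡2^n*w (*-identityʳ (2 ^ n)) , trans (sym (*-identityˡ (u + P))) w*[u+P]≡q^y))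
...   | inj₂ u+P≡1 = contradiction u+P≡1 (>⇒≢ (≤-trans (∣⇒≤ {{u≢0}} 2∣u) (m≤m+n u P)))
  where
  u≢0 : NonZero u
  u≢0 = m*n≢0⇒m≢0 u {{subst NonZero (sym eq)
          (m*n≢0 (2 ^ n) (q ^ y) {{m^n≢0 2 n}} {{m^n≢0 q y {{prime⇒nonZero q-prime}}}})}}

square-gap : ∀ m n o → m * m + n ≡ o * o → ∃[ d ] o ≡ m + d × d * (d + 2 * m) ≡ n
square-gap m n o eq with m≤n⇒∃[o]m+o≡n m≤o
  where
  m≤o : m ≤ o
  m≤o = ≮⇒≥ λ o<m → <⇒≱ (*-mono-< o<m o<m) (≤-trans (m≤m+n (m * m) n) (≤-reflexive eq))
... | d , m+d≡o = d , sym m+d≡o , +-cancelˡ-≡ (m * m) (d * (d + 2 * m)) n (begin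
  m * m + d * (d + 2 * m)  ≡⟨ expand m d ⟩
  (m + d) * (m + d)        ≡⟨ cong₂ _*_ m+d≡o m+d≡o ⟩
  o * o                    ≡⟨ sym eq ⟩
  m * m + n                ∎)
  where
  expand : ∀ m d → m * m + d * (d + 2 * m) ≡ (m + d) * (m + d)
  expand = solve-∀

square-gap-even : ∀ m n o → m * m + 4 * n ≡ o * o → ∃[ a ] o ≡ m + 2 * a × a * (a + m) ≡ n
square-gap-even m n o eq with square-gap m (4 * n) o eq
... | d , o≡m+d , gap with 2∣d
  where
  2∣d : 2 ∣ d
  2∣d = [ id , (λ 2∣d+2m → ∣m+n∣m⇒∣n (subst (2 ∣_) (+-comm d (2 * m)) 2∣d+2m) (m∣m*n m)) ]′
          (euclidsLemma d (d + 2 * m) prime[2] (subst (2 ∣_) (sym gap) (∣m⇒∣m*n n (divides 2 refl))))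
...   | divides a refl =
  a , trans o≡m+d (cong (m +_) (*-comm a 2)) , *-cancelˡ-≡ (a * (a + m)) n 4 (trans (quadruple a m) gap)
  where
  quadruple : ∀ a m → 4 * (a * (a + m)) ≡ a * 2 * (a * 2 + 2 * m)
  quadruple = solve-∀

m*n≡2⇒ : ∀ m n → m * n ≡ 2 → (m ≡ 1 × n ≡ 2) ⊎ (m ≡ 2 × n ≡ 1)
m*n≡2⇒ 0 n ()
m*n≡2⇒ 1 n eq = inj₁ (refl , trans (sym (+-identityʳ n)) eq)
m*n≡2⇒ 2 n eq = inj₂ (refl , *-cancelˡ-≡ n 1 2 eq)
m*n≡2⇒ (suc (suc (suc m))) n eq =
  contradiction (∣⇒≤ (divides n (trans (sym eq) (*-comm (3 + m) n)))) λ { (s≤s (s≤s ())) }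

1+3^r≡4*7^y⇒ : ∀ k y r → k * y ≡ 2 → 1 + 3 ^ r ≡ 4 * 7 ^ y → k ≡ 2 × r ≡ 3 × y ≡ 1
1+3^r≡4*7^y⇒ k y r ky≡2 eq with m*n≡2⇒ k y ky≡2
... | inj₁ (refl , refl) =
  contradiction (+-cancelˡ-≡ 1 (3 ^ r) 195 eq) (^-between 3 4 (from-yes (81 <? 195)) (from-yes (195 <? 243)) r)
... | inj₂ (refl , refl) = refl , ^-injectiveʳ (from-yes (1 <? 3)) (+-cancelˡ-≡ 1 (3 ^ r) (3 ^ 3) eq) , refl

4+3^r≡7^y⇒ : ∀ k y r → k * y ≡ 2 → 4 + 3 ^ r ≡ 7 ^ y → k ≡ 2 × r ≡ 1 × y ≡ 1
4+3^r≡7^y⇒ k y r ky≡2 eq with m*n≡2⇒ k y ky≡2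
... | inj₁ (refl , refl) =
  contradiction (+-cancelˡ-≡ 4 (3 ^ r) 45 eq) (^-between 3 3 (from-yes (27 <? 45)) (from-yes (45 <? 81)) r)
... | inj₂ (refl , refl) = refl , ^-injectiveʳ (from-yes (1 <? 3)) (+-cancelˡ-≡ 4 (3 ^ r) (3 ^ 1) eq) , refl

module SophieGermain {p : ℕ} (p-prime : Prime p) (q-prime : Prime (2 * p + 1)) (p%8≡3 : p % 8 ≡ 3) where

  q : ℕ
  q = 2 * p + 1

  instance
    p≢0 : NonZero p
    p≢0 = prime⇒nonZero p-prime

  3≤p : 3 ≤ p
  3≤p = subst (_≤ p) p%8≡3 (m%n≤m p 8)

  7≤q : 7 ≤ q
  7≤q = +-monoˡ-≤ 1 (*-monoʳ-≤ 2 3≤p)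

  7≤q^[1+] : ∀ y → 7 ≤ q ^ suc y
  7≤q^[1+] y = ≤-trans 7≤q (m≤m*n q (q ^ y) {{m^n≢0 q y {{prime⇒nonZero q-prime}}}})

  7≤q^[1+]+p^ : ∀ y r → 7 ≤ q ^ suc y + p ^ r
  7≤q^[1+]+p^ y r = ≤-trans (7≤q^[1+] y) (m≤m+n (q ^ suc y) (p ^ r))

  p<q : p < q
  p<q = subst (p <_) (+-comm 1 (2 * p)) (s≤s (m≤m+n p (p + 0)))

  p∤2 : ¬ p ∣ 2
  p∤2 p∣2 = <⇒≱ 3≤p (∣⇒≤ p∣2)

  q∤p^ : ∀ r → ¬ q ∣ p ^ r
  q∤p^ = prime∤⇒∤^ q-prime (λ q∣p → <⇒≱ p<q (∣⇒≤ q∣p))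

  q∤2p^ : ∀ r → ¬ q ∣ 2 * p ^ r
  q∤2p^ r q∣2p^r = [ (λ q∣2 → <⇒≱ (≤-trans (from-yes (2 <? 7)) 7≤q) (∣⇒≤ q∣2)) , q∤p^ r ]′
    (euclidsLemma 2 (p ^ r) q-prime q∣2p^r)

  p%2≡1 : p % 2 ≡ 1
  p%2≡1 = trans (sym (m∣n⇒o%n%m≡o%m 2 8 p (divides 4 refl))) (cong (_% 2) p%8≡3)

  p%4≡3 : p % 4 ≡ 3
  p%4≡3 = trans (sym (m∣n⇒o%n%m≡o%m 4 8 p (divides 2 refl))) (cong (_% 4) p%8≡3)

  q%8≡7 : q % 8 ≡ 7
  q%8≡7 = +-%-cong 8 (2 * p) 1 (*-%-cong 8 2 p refl p%8≡3) refl

  q%2≡1 : q % 2 ≡ 1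
  q%2≡1 = trans (sym (m∣n⇒o%n%m≡o%m 2 8 q (divides 4 refl))) (cong (_% 2) q%8≡7)

  p^%2≡1 : ∀ r → p ^ r % 2 ≡ 1
  p^%2≡1 = ^-%≡1 2 p p%2≡1

  q^%2≡1 : ∀ y → q ^ y % 2 ≡ 1
  q^%2≡1 = ^-%≡1 2 q q%2≡1

  q^%p≡1 : ∀ y → q ^ y % p ≡ 1 % p
  q^%p≡1 = ^-%≡1 p q (%-remove-+ˡ 1 {p} (n∣m*n 2))

  p^even%8 : ∀ s → p ^ (2 * s) % 8 ≡ 1
  p^even%8 = ^-even-% 8 p (*-%-cong 8 p p p%8≡3 p%8≡3)

  p^odd%8 : ∀ s → p ^ (1 + 2 * s) % 8 ≡ 3
  p^odd%8 s = trans (^-odd-% 8 p (*-%-cong 8 p p p%8≡3 p%8≡3) s) p%8≡3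

  q^even%8 : ∀ s → q ^ (2 * s) % 8 ≡ 1
  q^even%8 = ^-even-% 8 q (*-%-cong 8 q q q%8≡7 q%8≡7)

  q^odd%8 : ∀ s → q ^ (1 + 2 * s) % 8 ≡ 7
  q^odd%8 s = trans (^-odd-% 8 q (*-%-cong 8 q q q%8≡7 q%8≡7) s) q%8≡7

  p^odd%4 : ∀ s → p ^ (1 + 2 * s) % 4 ≡ 3
  p^odd%4 s = trans (^-odd-% 4 p (*-%-cong 4 p p p%4≡3 p%4≡3) s) p%4≡3

  4^[2+n]%8 : ∀ n → 2 ^ (2 * (2 + n)) % 8 ≡ 0
  4^[2+n]%8 n = n∣m⇒m%n≡0 _ 8 (8∣4^[2+n] n)

  2∤p^ : ∀ r → ¬ 2 ∣ p ^ r
  2∤p^ r 2∣p^r = contradiction (trans (sym (n∣m⇒m%n≡0 _ 2 2∣p^r)) (p^%2≡1 r)) λ ()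

  1+p^≢q^ : ∀ r y → 1 + p ^ r ≢ q ^ y
  1+p^≢q^ r y = residues≢⇒≢ 2 (+-%-cong 2 1 (p ^ r) refl (p^%2≡1 r)) (q^%2≡1 y) λ ()

  8∤1+p^ : ∀ r → ¬ 8 ∣ 1 + p ^ r
  8∤1+p^ r 8∣1+p^r with evenOdd r
  ... | even s = contradiction (trans (sym (n∣m⇒m%n≡0 _ 8 8∣1+p^r)) (+-%-cong 8 1 (p ^ (2 * s)) refl (p^even%8 s)))
                   λ ()
  ... | odd s  = contradiction (trans (sym (n∣m⇒m%n≡0 _ 8 8∣1+p^r)) (+-%-cong 8 1 (p ^ (1 + 2 * s)) refl (p^odd%8 s)))
                   λ ()

  reduce-mod-p : ∀ a b r y → a + p ^ suc r ≡ b * q ^ y → a % p ≡ b % p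
  reduce-mod-p a b r y eq = begin
    a % p                ≡⟨ sym (%-remove-+ʳ a (m∣m*n (p ^ r))) ⟩
    (a + p ^ suc r) % p  ≡⟨ %-congˡ eq ⟩
    (b * q ^ y) % p      ≡⟨ *-%≡1ʳ p b (q^%p≡1 y) ⟩
    b % p                ∎

  1<p : 1 < p
  1<p = ≤-trans (s≤s (s≤s z≤n)) 3≤p

  1≡4-mod-p⇒p≡3 : 1 % p ≡ 4 % p → p ≡ 3
  1≡4-mod-p⇒p≡3 eq with p ≤? 4
  ... | no p≰4  = contradiction (trans (sym (m<n⇒m%n≡m 1<p)) (trans eq (m<n⇒m%n≡m (≰⇒> p≰4)))) λ ()
  ... | yes p≤4 = ≤-antisym (≤-pred (≤∧≢⇒< p≤4 p≢4)) 3≤p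
    where
    p≢4 : p ≢ 4
    p≢4 refl = contradiction p%8≡3 λ ()

  2+p^≢q^ : ∀ s u → 2 + p ^ s ≢ q ^ u
  2+p^≢q^ s       zero    ()
  2+p^≢q^ zero    (suc u) eq = contradiction (≤-trans (7≤q^[1+] u) (≤-reflexive (sym eq))) (from-no (7 ≤? 3))
  2+p^≢q^ (suc s) (suc u) eq = contradiction
    (trans (sym (m<n⇒m%n≡m 3≤p)) (trans (reduce-mod-p 2 1 s (suc u) (trans eq (sym (*-identityˡ _)))) (m<n⇒m%n≡m 1<p)))
    λ ()

  p^≡3⇒ : ∀ s → p ^ s ≡ 3 → p ≡ 3 × s ≡ 1
  p^≡3⇒ zero    ()
  p^≡3⇒ (suc s) eq with ≤-antisym (∣⇒≤ (subst (p ∣_) eq (m∣m*n (p ^ s)))) 3≤p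
  ... | refl = refl , ^-injectiveʳ (from-yes (1 <? 3)) {n = 1} eq

  1+p^≡4^*q^⇒ : ∀ k y n r → k * y ≡ suc n → 1 + p ^ r ≡ 2 ^ (2 * n) * q ^ y →
    p ≡ 3 × k ≡ 2 × r ≡ 3 × y ≡ 1
  1+p^≡4^*q^⇒ k y zero r _ eq = contradiction (trans eq (*-identityˡ (q ^ y))) (1+p^≢q^ r y)
  1+p^≡4^*q^⇒ k y (suc (suc n)) r _ eq =
    contradiction (subst (8 ∣_) (sym eq) (∣m⇒∣m*n (q ^ y) (8∣4^[2+n] n))) (8∤1+p^ r)
  1+p^≡4^*q^⇒ k y 1 zero _ eq = contradiction eq (residues≢⇒≢ 4 refl (n∣m⇒m%n≡0 _ 4 (m∣m*n (q ^ y))) λ ())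
  1+p^≡4^*q^⇒ k y 1 (suc r) ky≡2 eq with 1≡4-mod-p⇒p≡3 (reduce-mod-p 1 4 r y eq)
  ... | refl = refl , 1+3^r≡4*7^y⇒ k y (suc r) ky≡2 eq

  -- The two factors of (q^u)² - (p^s)² = 2^(2n+4) are powers of 2, so q^u = p^s + 2: impossible mod p.
  4^[2+n]+p^²≢q^² : ∀ n s u → 2 ^ (2 * (2 + n)) + p ^ (2 * s) ≢ q ^ (2 * u)
  4^[2+n]+p^²≢q^² n s u eq with square-gap-even (p ^ s) (2 ^ (2 * suc n) * q ^ 0) (q ^ u) squares
    where
    squares : p ^ s * p ^ s + 4 * (2 ^ (2 * suc n) * q ^ 0) ≡ q ^ u * q ^ u
    squares = begin
      p ^ s * p ^ s + 4 * (2 ^ (2 * suc n) * 1)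
        ≡⟨ cong₂ _+_ (sym (^-double p s)) (trans (cong (4 *_) (*-identityʳ (2 ^ (2 * suc n)))) (sym (4^suc (suc n)))) ⟩
      p ^ (2 * s) + 2 ^ (2 * (2 + n))  ≡⟨ +-comm (p ^ (2 * s)) _ ⟩
      2 ^ (2 * (2 + n)) + p ^ (2 * s)  ≡⟨ eq ⟩
      q ^ (2 * u)                      ≡⟨ ^-double q u ⟩
      q ^ u * q ^ u                    ∎
  ... | a , q^u≡p^s+2a , gap with factor-pair-split q-prime (2∤p^ s) (q∤p^ s) a (2 * suc n) 0 gap
  ...   | inj₁ (refl , _)            = 2+p^≢q^ s u (trans (+-comm 2 (p ^ s)) (sym q^u≡p^s+2a))
  ...   | inj₂ (inj₂ (refl , _))     = 2+p^≢q^ s u (trans (+-comm 2 (p ^ s)) (sym q^u≡p^s+2a))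
  ...   | inj₂ (inj₁ (refl , 2^j+p^s≡1)) = contradiction 2^j+p^s≡1 (>⇒≢ (+-mono-≤ (m^n>0 2 (2 * suc n)) (m^n>0 p s)))

  4^[2+n]+p^≢q^ : ∀ n r y → 2 ^ (2 * (2 + n)) + p ^ r ≢ q ^ y
  4^[2+n]+p^≢q^ n r y with evenOdd r | evenOdd y
  ... | even s | even u = 4^[2+n]+p^²≢q^² n s u
  ... | even s | odd u  = residues≢⇒≢ 8 (trans (%-remove-+ˡ _ (8∣4^[2+n] n)) (p^even%8 s)) (q^odd%8 u) λ ()
  ... | odd s  | even u = residues≢⇒≢ 8 (trans (%-remove-+ˡ _ (8∣4^[2+n] n)) (p^odd%8 s)) (q^even%8 u) λ ()
  ... | odd s  | odd u  = residues≢⇒≢ 8 (trans (%-remove-+ˡ _ (8∣4^[2+n] n)) (p^odd%8 s)) (q^odd%8 u) λ ()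

  4^+p^≡q^⇒ : ∀ k y n r → k * y ≡ suc n → 2 ^ (2 * n) + p ^ r ≡ q ^ y → p ≡ 3 × k ≡ 2 × r ≡ 1 × y ≡ 1
  4^+p^≡q^⇒ k y zero r _ eq = contradiction eq (1+p^≢q^ r y)
  4^+p^≡q^⇒ k y (suc (suc n)) r _ eq = contradiction eq (4^[2+n]+p^≢q^ n r y)
  4^+p^≡q^⇒ k zero 1 zero _ ()
  4^+p^≡q^⇒ k (suc y) 1 zero _ eq = contradiction (≤-trans (7≤q^[1+] y) (≤-reflexive (sym eq))) (from-no (7 ≤? 5))
  4^+p^≡q^⇒ k y 1 (suc r) ky≡2 eq
    with 1≡4-mod-p⇒p≡3 (sym (reduce-mod-p 4 1 r y (trans eq (sym (*-identityˡ (q ^ y))))))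
  ... | refl = refl , 4+3^r≡7^y⇒ k y (suc r) ky≡2 eq

  q^+p^²≡4^[2+n]⇒ : ∀ n s y → q ^ y + p ^ (2 * s) ≡ 2 ^ (2 * (2 + n)) → p ≡ 3 × n ≡ 0 × s ≡ 1 × y ≡ 1
  q^+p^²≡4^[2+n]⇒ n s y eq with square-gap (p ^ s) (q ^ y) (2 ^ (2 + n)) squares
    where
    squares : p ^ s * p ^ s + q ^ y ≡ 2 ^ (2 + n) * 2 ^ (2 + n)
    squares = begin
      p ^ s * p ^ s + q ^ y  ≡⟨ cong (_+ q ^ y) (sym (^-double p s)) ⟩
      p ^ (2 * s) + q ^ y    ≡⟨ +-comm (p ^ (2 * s)) (q ^ y) ⟩
      q ^ y + p ^ (2 * s)    ≡⟨ eq ⟩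
      2 ^ (2 * (2 + n))      ≡⟨ ^-double 2 (2 + n) ⟩
      2 ^ (2 + n) * 2 ^ (2 + n) ∎
  ... | d , 2^[2+n]≡p^s+d , gap with m*[m+n]≡p^⇒m≡1 {m = d} {k = y} q-prime (q∤2p^ s) gap
  ... | refl with n
  ...   | suc n = contradiction (subst (8 ∣_) (trans 2^[2+n]≡p^s+d (+-comm (p ^ s) 1)) (8∣2^[3+n] n)) (8∤1+p^ s)
  ...   | zero with p^≡3⇒ s (+-cancelʳ-≡ 1 (p ^ s) 3 (sym 2^[2+n]≡p^s+d))
  ...     | refl , refl = refl , refl , refl , ^-injectiveʳ (from-yes (1 <? 7)) {n = 1} (sym gap)

  q^+p^≡4^[2+n]⇒ : ∀ n r y → q ^ y + p ^ r ≡ 2 ^ (2 * (2 + n)) → p ≡ 3 × n ≡ 0 × r ≡ 2 × y ≡ 1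
  q^+p^≡4^[2+n]⇒ n r y eq with evenOdd y | evenOdd r
  ... | odd u  | even s with q^+p^²≡4^[2+n]⇒ n s (1 + 2 * u) eq
  ...   | p≡3 , n≡0 , refl , y≡1 = p≡3 , n≡0 , refl , y≡1
  q^+p^≡4^[2+n]⇒ n r y eq | even u | even s =
    contradiction eq (residues≢⇒≢ 8 (+-%-cong 8 (q ^ (2 * u)) (p ^ (2 * s)) (q^even%8 u) (p^even%8 s)) (4^[2+n]%8 n)
      λ ())
  q^+p^≡4^[2+n]⇒ n r y eq | even u | odd s =
    contradiction eq (residues≢⇒≢ 8 (+-%-cong 8 (q ^ (2 * u)) (p ^ (1 + 2 * s)) (q^even%8 u) (p^odd%8 s)) (4^[2+n]%8 n)
      λ ())
  q^+p^≡4^[2+n]⇒ n r y eq | odd u | odd s =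
    contradiction eq (residues≢⇒≢ 8 (+-%-cong 8 (q ^ (1 + 2 * u)) (p ^ (1 + 2 * s)) (q^odd%8 u) (p^odd%8 s)) (4^[2+n]%8 n)
      λ ())

  q^+p^≡4^⇒ : ∀ k y n r → k * y ≡ suc n → q ^ y + p ^ r ≡ 2 ^ (2 * n) → p ≡ 3 × k ≡ 3 × r ≡ 2 × y ≡ 1
  q^+p^≡4^⇒ k zero n r ky≡1+n _ = contradiction (trans (sym (*-zeroʳ k)) ky≡1+n) λ ()
  q^+p^≡4^⇒ k (suc y) zero r _ eq = contradiction (subst (7 ≤_) eq (7≤q^[1+]+p^ y r)) (from-no (7 ≤? 1))
  q^+p^≡4^⇒ k (suc y) 1    r _ eq = contradiction (subst (7 ≤_) eq (7≤q^[1+]+p^ y r)) (from-no (7 ≤? 4))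
  q^+p^≡4^⇒ k (suc y) (suc (suc n)) r ky≡1+n eq with q^+p^≡4^[2+n]⇒ n r (suc y) eq
  ... | p≡3 , refl , r≡2 , refl = p≡3 , trans (sym (*-identityʳ k)) ky≡1+n , r≡2 , refl

  y≡0-solution : ∀ x z → p ^ x + 1 ≡ z ^ 2 → p ≡ 3 × x ≡ 1 × z ≡ 2
  y≡0-solution x z eq
    with square-gap 1 (p ^ x) z (trans (+-comm 1 (p ^ x)) (trans eq (cong (z *_) (*-identityʳ z))))
  ... | d , z≡1+d , gap with m*[m+n]≡p^⇒m≡1 {m = d} {k = x} p-prime p∤2 gap
  ... | refl with p^≡3⇒ x (sym gap)
  ...   | refl , refl = refl , refl , z≡1+d

  p^odd+4*≢square : ∀ s m z → p ^ (1 + 2 * s) + 4 * m ≢ z * z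
  p^odd+4*≢square s m z eq =
    square%4≢3 z (trans (sym (%-congˡ eq)) (+-%-cong 4 (p ^ (1 + 2 * s)) (4 * m) (p^odd%4 s) (n∣m⇒m%n≡0 _ 4 (m∣m*n m))))

  positive-y-solutions : ∀ k x y z → p ^ x + (2 ^ (2 * suc k) * q) ^ suc y ≡ z ^ 2 →
      (p ≡ 3 × suc k ≡ 2 × x ≡ 6 × suc y ≡ 1 × z ≡ 29)
    ⊎ (p ≡ 3 × suc k ≡ 2 × x ≡ 2 × suc y ≡ 1 × z ≡ 11)
    ⊎ (p ≡ 3 × suc k ≡ 3 × x ≡ 4 × suc y ≡ 1 × z ≡ 23)
  positive-y-solutions k x y z eq
    with evenOdd x | trans (cong (p ^ x +_) (sym ([4^k*c]^y k y q))) (trans eq (cong (z *_) (*-identityʳ z)))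
  ... | odd s  | eq′ = contradiction eq′ (p^odd+4*≢square s (2 ^ (2 * (y + k * suc y)) * q ^ suc y) z)
  ... | even r | eq′ with square-gap-even (p ^ r) _ z (subst (λ t → t + _ ≡ z * z) (^-double p r) eq′)
  ... | a , z≡ , gap with factor-pair-split q-prime (2∤p^ r) (q∤p^ r) a (2 * (y + k * suc y)) (suc y) gap
  ... | inj₁ (refl , e) with 1+p^≡4^*q^⇒ (suc k) (suc y) _ r refl e
  ...   | refl , refl , refl , refl = inj₁ (refl , refl , refl , refl , z≡)
  positive-y-solutions k x y z eq | even r | _ | a , z≡ , _ | inj₂ (inj₁ (refl , e))
    with 4^+p^≡q^⇒ (suc k) (suc y) _ r refl e
  ...   | refl , refl , refl , refl = inj₂ (inj₁ (refl , refl , refl , refl , z≡))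
  positive-y-solutions k x y z eq | even r | _ | a , z≡ , _ | inj₂ (inj₂ (refl , e))
    with q^+p^≡4^⇒ (suc k) (suc y) _ r refl e
  ...   | refl , refl , refl , refl = inj₂ (inj₂ (refl , refl , refl , refl , z≡))

open SophieGermain using (y≡0-solution; positive-y-solutions)

theorem4p2 : (p k x y z : ℕ) → SophieGermainPrime p → p % 8 ≡ 3 → k ≥ 1 →
    p ^ x + (2 ^ (2 * k) * (2 * p + 1)) ^ y ≡ z ^ 2 →
    (p ≡ 3 × x ≡ 1 × y ≡ 0 × z ≡ 2)
    ⊎ (p ≡ 3 × k ≡ 2 × x ≡ 6 × y ≡ 1 × z ≡ 29)
    ⊎ (p ≡ 3 × k ≡ 2 × x ≡ 2 × y ≡ 1 × z ≡ 11)
    ⊎ (p ≡ 3 × k ≡ 3 × x ≡ 4 × y ≡ 1 × z ≡ 23)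
theorem4p2 p k x zero z (p-prime , q-prime) p%8≡3 _ eq with y≡0-solution p-prime q-prime p%8≡3 x z eq
... | p≡3 , x≡1 , z≡2 = inj₁ (p≡3 , x≡1 , refl , z≡2)
theorem4p2 p zero x (suc y) z _ _ () _
theorem4p2 p (suc k) x (suc y) z (p-prime , q-prime) p%8≡3 _ eq =
  inj₂ (positive-y-solutions p-prime q-prime p%8≡3 k x y z eq)
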